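{- Let $p$ be an odd prime, $L=\langle -1,2\rangle\le\mathbb{Z}_p^{\times}$, $\ell=[\mathbb{Z}_p^{\times}:L]$, and assume $\ell\ge 3$. For a primitive root $g$ of $\mathbb{Z}_p$ define $A_g(i,j)=|(1+g^iL)\cap g^jL|$ for integers $i,j$ and $s_g(\ell)=\sum_{1\le i\le\ell,\ \gcd(i,\ell)=1}A_g(i,2i)$. Then $s_g(\ell)$ does not depend on the choice of the primitive root $g$: $s_g(\ell)=s_h(\ell)$ for any two primitive roots $g,h$ of $\mathbb{Z}_p$.
   Context: $\mathbb{Z}_p=\mathbb{Z}/p\mathbb{Z}$, $\mathbb{Z}_p^{\times}=\mathbb{Z}_p\setminus\{0\}$; $\langle -1,2\rangle$ is the subgroup generated by $-1$ and $2$. A primitive root is a generator of $\mathbb{Z}_p^{\times}$. For $S\subseteq\mathbb{Z}_p$, $a+S=\{a+s:s\in S\}$, $aS=\{as:s\in S\}$. -}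

module Defs where

open import Data.Nat using (ℕ; zero; suc; _+_; _*_; _∸_; _^_; _≟_; NonZero)
open import Data.Nat.DivMod using (_%_)
open import Data.Nat.GCD using (gcd)
open import Data.List using (List; []; map; upTo; _++_; filter; length)
open import Data.Nat.ListAction using (sum)
open import Data.List.Relation.Unary.Any using (Any; any?)
open import Data.Product using (_×_; ∃)
open import Relation.Binary.PropositionalEquality using (_≡_)
open import Relation.Nullary using (¬_; Dec)
open import Relation.Nullary.Decidable using (_×-dec_)

-- Residues of ℤ_p are represented by naturals 0 … p-1; arithmetic is mod p.
-- Everything below is only used for a prime p (so p ≥ 2), but is defined for p = suc q
-- to have % available.

-- The subgroup L = ⟨-1, 2⟩ of ℤ_p^× : since ℤ_p^× is abelian of order p-1 and
-- 2^(p-1) = 1, its elements are exactly (-1)^a 2^b with a ∈ {0,1}, 0 ≤ b < p-1.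
Lelems : ℕ → List ℕ
Lelems zero = []
Lelems (suc q) =
  map (λ b → (2 ^ b) % suc q) (upTo q) ++
  map (λ b → (suc q ∸ (2 ^ b) % suc q) % suc q) (upTo q)

InCoset : ℕ → ℕ → ℕ → ℕ → Set
InCoset zero a c x = Any (λ y → a + c * y ≡ x) []
InCoset (suc q) a c x = Any (λ y → (a + c * y) % suc q ≡ x) (Lelems (suc q))

inCoset? : ∀ p a c x → Dec (InCoset p a c x)
inCoset? zero a c x = any? (λ y → a + c * y ≟ x) []
inCoset? (suc q) a c x = any? (λ y → (a + c * y) % suc q ≟ x) (Lelems (suc q))

cardL : ℕ → ℕ
cardL p = length (filter (λ x → inCoset? p 0 1 x) (upTo p))

A : ℕ → ℕ → ℕ → ℕ → ℕ
A p g i j = length (filter (λ x → inCoset? p 1 (g ^ i) x ×-dec inCoset? p 0 (g ^ j) x) (upTo p))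

s : ℕ → ℕ → ℕ → ℕ
s p g ℓ = sum (map (λ i → A p g i (2 * i)) (filter (λ i → gcd i ℓ ≟ 1) (map suc (upTo ℓ))))

IsPrimitiveRoot : (p : ℕ) → .{{_ : NonZero p}} → ℕ → Set
IsPrimitiveRoot p g = ¬ (g % p ≡ 0) × (∀ x → ¬ (x % p ≡ 0) → ∃ λ k → (g ^ k) % p ≡ x % p)

{-# OPTIONS --safe #-}

-- Write h = g ^ k.  The exponents j with g ^ j ∈ L are the multiples of some d, and
-- L = {g ^ (d t) : t < (p − 1)/d}, so |L| = (p − 1)/d and d is the index ℓ.  Hence
-- A_g(i, j) depends only on i and j modulo ℓ, and A_h(i, 2i) = A_g(ki, 2ki).  As g is
-- also a power h ^ k′ with k k′ ≡ 1 (mod p − 1), multiplication by k permutes the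
-- residues coprime to ℓ, and reindexing the sum turns s_h(ℓ) into s_g(ℓ).
module Submission where

open import Data.Nat
open import Data.Nat.Properties
open import Data.Nat.DivMod
open import Data.Nat.Divisibility
open import Data.Nat.GCD using (gcd; gcd-greatest; gcd[m,n]∣m; gcd[m,n]∣n)
open import Data.Nat.Primality using (Prime; euclidsLemma; prime⇒nonTrivial)
open import Data.Nat.ListAction using (sum)
open import Data.Nat.ListAction.Properties using (sum-↭)
open import Data.Fin using (Fin; toℕ; fromℕ<)
open import Data.Fin.Properties using (pigeonhole; injective⇒≤; toℕ-fromℕ<; toℕ-injective; toℕ<n)
open import Data.Empty using (⊥-elim)
open import Data.Product using (∃; ∃-syntax; _×_; _,_; proj₁; proj₂)
open import Data.Sum using (_⊎_; inj₁; inj₂; [_,_]′)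
open import Data.List using (List; map; upTo; filter; length)
open import Data.List.Properties using (length-map; length-upTo; filter-≐; map-∘; map-cong)
open import Data.List.Membership.Propositional using (_∈_; find; lose)
open import Data.List.Membership.Propositional.Properties
  using (∈-map⁺; ∈-map⁻; ∈-++⁺ˡ; ∈-++⁺ʳ; ∈-++⁻; ∈-upTo⁺; ∈-upTo⁻; ∈-filter⁺; ∈-filter⁻)
open import Data.List.Membership.Propositional.Properties.WithK using (unique∧set⇒bag)
open import Data.List.Relation.Unary.Any using (here; there)
import Data.List.Relation.Unary.All as All
import Data.List.Relation.Unary.All.Properties as All
open import Data.List.Relation.Unary.AllPairs using ([]; _∷_)
open import Data.List.Relation.Unary.Unique.Propositional using (Unique)
import Data.List.Relation.Unary.Unique.Propositional.Properties as Unique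
open import Data.List.Relation.Binary.Permutation.Propositional using (_↭_)
import Data.List.Relation.Binary.Permutation.Propositional.Properties as ↭
open import Data.List.Relation.Binary.BagAndSetEquality using (∼bag⇒↭)
open import Algebra.Properties.CommutativeSemigroup *-commutativeSemigroup
  using () renaming (interchange to *-interchange; x∙yz≈y∙xz to *-left-comm)
open import Function using (_∘_)
open import Function.Bundles using (mk⇔)
open import Level using (0ℓ)
open import Relation.Nullary using (¬_; yes; no; contradiction; map′)
open import Relation.Nullary.Decidable using (_×-dec_)
open import Relation.Unary using (Pred; Decidable; _≐_)
open import Relation.Binary.Bundles using (Setoid)
open import Relation.Binary.PropositionalEquality
import Relation.Binary.Reasoning.Setoid as SetoidReasoning

open import Defs

map⁺-injectiveOn : {A B : Set} {f : A → B} {xs : List A} →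
                   (∀ {x y} → x ∈ xs → y ∈ xs → f x ≡ f y → x ≡ y) →
                   Unique xs → Unique (map f xs)
map⁺-injectiveOn inj [] = []
map⁺-injectiveOn inj (x∉xs ∷ xs!) =
  All.map⁺ (All.tabulate λ y∈xs fx≡fy → All.lookup x∉xs y∈xs (inj (here refl) (there y∈xs) fx≡fy))
  ∷ map⁺-injectiveOn (λ x∈ y∈ → inj (there x∈) (there y∈)) xs!

unique∧set⇒↭ : {A : Set} {xs ys : List A} → Unique xs → Unique ys →
               (∀ {x} → x ∈ xs → x ∈ ys) → (∀ {x} → x ∈ ys → x ∈ xs) → xs ↭ ys
unique∧set⇒↭ xs! ys! xs⊆ys ys⊆xs = ∼bag⇒↭ (unique∧set⇒bag xs! ys! (mk⇔ xs⊆ys ys⊆xs))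

∣∧<⇒≡0 : ∀ {m n} → m ∣ n → n < m → n ≡ 0
∣∧<⇒≡0 {n = zero} _ _ = refl
∣∧<⇒≡0 {n = suc _} m∣n n<m = contradiction m∣n (>⇒∤ n<m)

m%n≡o%n⇒m≡o : ∀ {m n o} .{{_ : NonZero n}} → m < n → o < n → m % n ≡ o % n → m ≡ o
m%n≡o%n⇒m≡o m<n o<n m%n≡o%n = trans (sym (m<n⇒m%n≡m m<n)) (trans m%n≡o%n (m<n⇒m%n≡m o<n))

%-≡⇒∣-+ : ∀ {d i i′ j} .{{_ : NonZero d}} → i % d ≡ i′ % d → d ∣ i′ + j → d ∣ i + j
%-≡⇒∣-+ {d} {i} {i′} {j} i≡i′ d∣i′+j = m%n≡0⇒n∣m (i + j) d (begin
  (i + j) % d               ≡⟨ %-distribˡ-+ i j d ⟩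
  (i % d + j % d) % d       ≡⟨ cong (λ r → (r + j % d) % d) i≡i′ ⟩
  (i′ % d + j % d) % d      ≡⟨ %-distribˡ-+ i′ j d ⟨
  (i′ + j) % d              ≡⟨ n∣m⇒m%n≡0 (i′ + j) d d∣i′+j ⟩
  0                         ∎)
  where open ≡-Reasoning

module _ {a} {P : Pred ℕ a} (P? : Decidable P) where

  ∃-least : ∀ {n} → P n → ∃[ d ] P d × (∀ {j} → j < d → ¬ P j)
  ∃-least = search 0 (λ ())
    where
    search : ∀ k {m} → (∀ {j} → j < k → ¬ P j) → P (k + m) → ∃[ d ] P d × (∀ {j} → j < d → ¬ P j)
    search k {zero} below Pk = k , subst P (+-identityʳ k) Pk , below
    search k {suc m} below Pk+m with P? k
    ... | yes Pk = k , Pk , below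
    ... | no ¬Pk = search (suc k) below′ (subst P (+-suc k m) Pk+m)
      where
      below′ : ∀ {j} → j < suc k → ¬ P j
      below′ j<1+k with m<1+n⇒m<n∨m≡n j<1+k
      ... | inj₁ j<k = below j<k
      ... | inj₂ refl = ¬Pk

-- A subgroup of (ℤ, +), seen through its non-negative part.
module _ {a} {P : Pred ℕ a} (P? : Decidable P)
         (+-closed : ∀ {a b} → P a → P b → P (a + b))
         (∸-closed : ∀ {a b} → P (a + b) → P b → P a) where

  ≐-multiples : ∀ {n} → P (suc n) → ∃[ d ] P ≐ (suc d ∣_)
  ≐-multiples P1+n with ∃-least {P = λ j → P (suc j)} (λ j → P? (suc j)) P1+n
  ... | d , Pd , below = d , d∣ , ∣⇒P
    where
    P0 : P 0
    P0 = ∸-closed {0} Pd Pd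

    multiple : ∀ q → P (q * suc d)
    multiple zero = P0
    multiple (suc q) = +-closed Pd (multiple q)

    ∣⇒P : ∀ {j} → suc d ∣ j → P j
    ∣⇒P (divides q refl) = multiple q

    d∣ : ∀ {j} → P j → suc d ∣ j
    d∣ {j} Pj with j % suc d in j%d≡r | m%n<n j (suc d)
    ... | zero | _ = m%n≡0⇒n∣m j (suc d) j%d≡r
    ... | suc r | s≤s r<d = ⊥-elim (below r<d (subst P j%d≡r Premainder))
      where
      Premainder : P (j % suc d)
      Premainder = ∸-closed (subst P (m≡m%n+[m/n]*n j (suc d)) Pj) (multiple (j / suc d))

module Congruence (m : ℕ) .{{_ : NonZero m}} where

  infix 4 _≈_
  record _≈_ (a b : ℕ) : Set where
    constructor ≡-mod
    field residue-≡ : a % m ≡ b % m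
  open _≈_ public

  ≈-refl : ∀ {a} → a ≈ a
  ≈-refl = ≡-mod refl

  ≈-sym : ∀ {a b} → a ≈ b → b ≈ a
  ≈-sym (≡-mod a≡b) = ≡-mod (sym a≡b)

  ≈-trans : ∀ {a b c} → a ≈ b → b ≈ c → a ≈ c
  ≈-trans (≡-mod a≡b) (≡-mod b≡c) = ≡-mod (trans a≡b b≡c)

  ≈-setoid : Setoid 0ℓ 0ℓ
  ≈-setoid = record
    { Carrier = ℕ
    ; _≈_ = _≈_
    ; isEquivalence = record { refl = ≈-refl ; sym = ≈-sym ; trans = ≈-trans }
    }

  module ≈-Reasoning = SetoidReasoning ≈-setoid

  ≡⇒≈ : ∀ {a b} → a ≡ b → a ≈ b
  ≡⇒≈ refl = ≈-refl

  %-≈ : ∀ a → a % m ≈ a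
  %-≈ a = ≡-mod (m%n%n≡m%n a m)

  +-cong : ∀ {a a′ b b′} → a ≈ a′ → b ≈ b′ → a + b ≈ a′ + b′
  +-cong {a} {a′} {b} {b′} (≡-mod a≡a′) (≡-mod b≡b′) = ≡-mod (begin
    (a + b) % m               ≡⟨ %-distribˡ-+ a b m ⟩
    (a % m + b % m) % m       ≡⟨ cong₂ (λ u v → (u + v) % m) a≡a′ b≡b′ ⟩
    (a′ % m + b′ % m) % m     ≡⟨ %-distribˡ-+ a′ b′ m ⟨
    (a′ + b′) % m             ∎)
    where open ≡-Reasoning

  *-cong : ∀ {a a′ b b′} → a ≈ a′ → b ≈ b′ → a * b ≈ a′ * b′
  *-cong {a} {a′} {b} {b′} (≡-mod a≡a′) (≡-mod b≡b′) = ≡-mod (begin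
    (a * b) % m               ≡⟨ %-distribˡ-* a b m ⟩
    (a % m * (b % m)) % m     ≡⟨ cong₂ (λ u v → (u * v) % m) a≡a′ b≡b′ ⟩
    (a′ % m * (b′ % m)) % m   ≡⟨ %-distribˡ-* a′ b′ m ⟨
    (a′ * b′) % m             ∎)
    where open ≡-Reasoning

  +-congˡ : ∀ a {b b′} → b ≈ b′ → a + b ≈ a + b′
  +-congˡ a = +-cong (≈-refl {a})

  *-congˡ : ∀ a {b b′} → b ≈ b′ → a * b ≈ a * b′
  *-congˡ a = *-cong (≈-refl {a})

  *-congʳ : ∀ {a a′} b → a ≈ a′ → a * b ≈ a′ * b
  *-congʳ b a≈a′ = *-cong a≈a′ (≈-refl {b})

  ^-congˡ : ∀ {a b} k → a ≈ b → a ^ k ≈ b ^ k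
  ^-congˡ zero a≈b = ≈-refl
  ^-congˡ (suc k) a≈b = *-cong a≈b (^-congˡ k a≈b)

  -- Adding (m − 1)·a undoes adding a.
  +-cancelˡ-≈ : ∀ a {x y} → a + x ≈ a + y → x ≈ y
  +-cancelˡ-≈ a {x} {y} a+x≈a+y = begin
    x                 ≈⟨ ≡-mod (%-remove-+ˡ x m∣t+a) ⟨
    t + a + x         ≡⟨ +-assoc t a x ⟩
    t + (a + x)       ≈⟨ +-congˡ t a+x≈a+y ⟩
    t + (a + y)       ≡⟨ +-assoc t a y ⟨
    t + a + y         ≈⟨ ≡-mod (%-remove-+ˡ y m∣t+a) ⟩
    y                 ∎
    where
    open ≈-Reasoning
    t : ℕ
    t = pred m * a
    m∣t+a : m ∣ t + a
    m∣t+a = divides a (trans (+-comm t a) (trans (cong (_* a) (suc-pred m)) (*-comm m a)))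

  ^-reduce : ∀ {b} r .{{_ : NonZero r}} → b ^ r ≈ 1 → ∀ k → b ^ k ≈ b ^ (k % r)
  ^-reduce {b} r b^r≈1 k = begin
    b ^ k                           ≡⟨ cong (b ^_) (m≡m%n+[m/n]*n k r) ⟩
    b ^ (k % r + k / r * r)         ≡⟨ ^-distribˡ-+-* b (k % r) (k / r * r) ⟩
    b ^ (k % r) * b ^ (k / r * r)   ≡⟨ cong (λ e → b ^ (k % r) * b ^ e) (*-comm (k / r) r) ⟩
    b ^ (k % r) * b ^ (r * (k / r)) ≡⟨ cong (b ^ (k % r) *_) (^-*-assoc b r (k / r)) ⟨
    b ^ (k % r) * (b ^ r) ^ (k / r) ≈⟨ *-congˡ (b ^ (k % r)) (^-congˡ (k / r) b^r≈1) ⟩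
    b ^ (k % r) * 1 ^ (k / r)       ≡⟨ cong (b ^ (k % r) *_) (^-zeroˡ (k / r)) ⟩
    b ^ (k % r) * 1                 ≡⟨ *-identityʳ (b ^ (k % r)) ⟩
    b ^ (k % r)                     ∎
    where open ≈-Reasoning

module Units (p : ℕ) .{{_ : NonZero p}} (p-prime : Prime p) where

  open Congruence p

  record Unit (x : ℕ) : Set where
    constructor unit
    field nonzero : ¬ (x % p ≡ 0)
  open Unit public

  Unit-≈ : ∀ {x y} → x ≈ y → Unit x → Unit y
  Unit-≈ (≡-mod x≡y) (unit x≢0) = unit λ y≡0 → x≢0 (trans x≡y y≡0)

  Unit-1 : Unit 1
  Unit-1 = unit λ 1%p≡0 → 1+n≢0 (trans (sym (m<n⇒m%n≡m 1<p)) 1%p≡0)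
    where
    1<p : 1 < p
    1<p = nonTrivial⇒n>1 p {{prime⇒nonTrivial p-prime}}

  Unit-* : ∀ {x y} → Unit x → Unit y → Unit (x * y)
  Unit-* {x} {y} (unit x≢0) (unit y≢0) = unit λ xy≡0 →
    [ (λ p∣x → x≢0 (n∣m⇒m%n≡0 x p p∣x)) , (λ p∣y → y≢0 (n∣m⇒m%n≡0 y p p∣y)) ]′
      (euclidsLemma x y p-prime (m%n≡0⇒n∣m (x * y) p xy≡0))

  Unit-^ : ∀ {x} k → Unit x → Unit (x ^ k)
  Unit-^ zero _ = Unit-1
  Unit-^ (suc k) ux = Unit-* ux (Unit-^ k ux)

  private
    *-cancelˡ-canonical : ∀ {u a b} → Unit u → a ≤ b → b < p → u * a ≈ u * b → a ≡ b
    *-cancelˡ-canonical {u} {a} {b} (unit u≢0) a≤b b<p ua≈ub = ≤-antisym a≤b (m∸n≡0⇒m≤n c≡0)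
      where
      c : ℕ
      c = b ∸ a
      uc≈0 : u * c ≈ 0
      uc≈0 = +-cancelˡ-≈ (u * a) (begin
        u * a + u * c   ≡⟨ *-distribˡ-+ u a c ⟨
        u * (a + c)     ≡⟨ cong (u *_) (m+[n∸m]≡n a≤b) ⟩
        u * b           ≈⟨ ua≈ub ⟨
        u * a           ≡⟨ +-identityʳ (u * a) ⟨
        u * a + 0       ∎)
        where open ≈-Reasoning
      c≡0 : c ≡ 0
      c≡0 with euclidsLemma u c p-prime (m%n≡0⇒n∣m (u * c) p (trans (residue-≡ uc≈0) (m*n%n≡0 0 p)))
      ... | inj₁ p∣u = ⊥-elim (u≢0 (n∣m⇒m%n≡0 u p p∣u))
      ... | inj₂ p∣c = ∣∧<⇒≡0 p∣c (≤-<-trans (m∸n≤m b a) b<p)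

  *-cancelˡ-≈ : ∀ {u x y} → Unit u → u * x ≈ u * y → x ≈ y
  *-cancelˡ-≈ {u} {x} {y} uu ux≈uy = ≡-mod (canonical (≤-total (x % p) (y % p)))
    where
    u[x%p]≈u[y%p] : u * (x % p) ≈ u * (y % p)
    u[x%p]≈u[y%p] = ≈-trans (*-congˡ u (%-≈ x)) (≈-trans ux≈uy (*-congˡ u (≈-sym (%-≈ y))))
    canonical : x % p ≤ y % p ⊎ y % p ≤ x % p → x % p ≡ y % p
    canonical (inj₁ x≤y) = *-cancelˡ-canonical uu x≤y (m%n<n y p) u[x%p]≈u[y%p]
    canonical (inj₂ y≤x) = sym (*-cancelˡ-canonical uu y≤x (m%n<n x p) (≈-sym u[x%p]≈u[y%p]))

  ^-≈⇒^∸≈1 : ∀ {x a b} → Unit x → a ≤ b → x ^ a ≈ x ^ b → x ^ (b ∸ a) ≈ 1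
  ^-≈⇒^∸≈1 {x} {a} {b} ux a≤b x^a≈x^b = *-cancelˡ-≈ (Unit-^ a ux) (begin
    x ^ a * x ^ (b ∸ a)   ≡⟨ ^-distribˡ-+-* x a (b ∸ a) ⟨
    x ^ (a + (b ∸ a))     ≡⟨ cong (x ^_) (m+[n∸m]≡n a≤b) ⟩
    x ^ b                 ≈⟨ x^a≈x^b ⟨
    x ^ a                 ≡⟨ *-identityʳ (x ^ a) ⟨
    x ^ a * 1             ∎)
    where open ≈-Reasoning

module PrimitiveRoot (n : ℕ) (p-prime : Prime (suc n)) (g : ℕ) (g-primitive : IsPrimitiveRoot (suc n) g) where

  p : ℕ
  p = suc n

  open Congruence p
  open Units p p-prime

  instance
    n-nonZero : NonZero n
    n-nonZero = >-nonZero (s≤s⁻¹ (nonTrivial⇒n>1 p {{prime⇒nonTrivial p-prime}}))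

  g-unit : Unit g
  g-unit = unit (proj₁ g-primitive)

  log : ∀ {x} → Unit x → ∃[ k ] g ^ k ≈ x
  log {x} (unit x≢0) with k , g^k≡x ← proj₂ g-primitive x x≢0 = k , ≡-mod g^k≡x

  pred-residue<n : ∀ k → pred (g ^ k % p) < n
  pred-residue<n k with g ^ k % p in eq | m%n<n (g ^ k) p
  ... | zero  | _ = ⊥-elim (nonzero (Unit-^ k g-unit) eq)
  ... | suc r | s≤s r<n = r<n

  ∃-period≤n : ∃[ r ] 0 < r × r ≤ n × g ^ r ≈ 1
  ∃-period≤n with pigeonhole (n<1+n n) (λ i → fromℕ< (pred-residue<n (toℕ i)))
  ... | i , j , i<j , fi≡fj = toℕ j ∸ toℕ i , m<n⇒0<n∸m i<j , j∸i≤n ,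
                              ^-≈⇒^∸≈1 g-unit (<⇒≤ i<j) (≡-mod g^i≡g^j)
    where
    j∸i≤n : toℕ j ∸ toℕ i ≤ n
    j∸i≤n = ≤-trans (m∸n≤m (toℕ j) (toℕ i)) (s≤s⁻¹ (toℕ<n j))
    residue≢0 : ∀ k → NonZero (g ^ k % p)
    residue≢0 k = ≢-nonZero (nonzero (Unit-^ k g-unit))
    g^i≡g^j : g ^ toℕ i % p ≡ g ^ toℕ j % p
    g^i≡g^j = begin
      g ^ toℕ i % p                ≡⟨ suc-pred (g ^ toℕ i % p) {{residue≢0 (toℕ i)}} ⟨
      suc (pred (g ^ toℕ i % p))   ≡⟨ cong suc (toℕ-fromℕ< _) ⟨
      suc (toℕ (fromℕ< _))         ≡⟨ cong (suc ∘ toℕ) fi≡fj ⟩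
      suc (toℕ (fromℕ< _))         ≡⟨ cong suc (toℕ-fromℕ< _) ⟩
      suc (pred (g ^ toℕ j % p))   ≡⟨ suc-pred (g ^ toℕ j % p) {{residue≢0 (toℕ j)}} ⟩
      g ^ toℕ j % p                ∎
      where open ≡-Reasoning

  -- The n units 1, …, n have distinct logarithms modulo any period r of g.
  n≤period : ∀ r .{{_ : NonZero r}} → g ^ r ≈ 1 → n ≤ r
  n≤period r g^r≈1 = injective⇒≤ {f = log-mod-r} log-mod-r-injective
    where
    unit-suc : (t : Fin n) → Unit (suc (toℕ t))
    unit-suc t = unit λ eq → 0≢1+n (trans (sym eq) (m<n⇒m%n≡m (s≤s (toℕ<n t))))
    log-mod-r : Fin n → Fin r
    log-mod-r t = fromℕ< (m%n<n (proj₁ (log (unit-suc t))) r)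
    log-mod-r-injective : ∀ {t t′} → log-mod-r t ≡ log-mod-r t′ → t ≡ t′
    log-mod-r-injective {t} {t′} eq = toℕ-injective (suc-injective
      (m%n≡o%n⇒m≡o (s≤s (toℕ<n t)) (s≤s (toℕ<n t′)) (residue-≡ (begin
        suc (toℕ t)    ≈⟨ proj₂ (log (unit-suc t)) ⟨
        g ^ k          ≈⟨ ^-reduce r g^r≈1 k ⟩
        g ^ (k % r)    ≡⟨ cong (g ^_) k≡k′ ⟩
        g ^ (k′ % r)   ≈⟨ ^-reduce r g^r≈1 k′ ⟨
        g ^ k′         ≈⟨ proj₂ (log (unit-suc t′)) ⟩
        suc (toℕ t′)   ∎))))
      where
      open ≈-Reasoning
      k k′ : ℕ
      k = proj₁ (log (unit-suc t))
      k′ = proj₁ (log (unit-suc t′))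
      k≡k′ : k % r ≡ k′ % r
      k≡k′ = trans (sym (toℕ-fromℕ< _)) (trans (cong toℕ eq) (toℕ-fromℕ< _))

  g^n≈1 : g ^ n ≈ 1
  g^n≈1 with ∃-period≤n
  ... | suc r , _ , r≤n , g^r≈1 = subst (λ e → g ^ e ≈ 1) (≤-antisym r≤n (n≤period (suc r) g^r≈1)) g^r≈1

  ^-cong-% : ∀ {a b} → a % n ≡ b % n → g ^ a ≈ g ^ b
  ^-cong-% {a} {b} a≡b = begin
    g ^ a         ≈⟨ ^-reduce n g^n≈1 a ⟩
    g ^ (a % n)   ≡⟨ cong (g ^_) a≡b ⟩
    g ^ (b % n)   ≈⟨ ^-reduce n g^n≈1 b ⟨
    g ^ b         ∎
    where open ≈-Reasoning

  ^-injective-% : ∀ {a b} → g ^ a ≈ g ^ b → a % n ≡ b % n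
  ^-injective-% {a} {b} g^a≈g^b = canonical (≤-total (a % n) (b % n))
    where
    g^a%n≈g^b%n : g ^ (a % n) ≈ g ^ (b % n)
    g^a%n≈g^b%n = ≈-trans (≈-sym (^-reduce n g^n≈1 a)) (≈-trans g^a≈g^b (^-reduce n g^n≈1 b))
    below-n : ∀ {a b} → a ≤ b → b < n → g ^ a ≈ g ^ b → a ≡ b
    below-n {a} {b} a≤b b<n g^a≈g^b with b ∸ a in eq | ^-≈⇒^∸≈1 g-unit a≤b g^a≈g^b
    ... | zero | _ = ≤-antisym a≤b (m∸n≡0⇒m≤n eq)
    ... | suc c | g^c≈1 = ⊥-elim (<⇒≱ (≤-<-trans (subst (_≤ b) eq (m∸n≤m b a)) b<n) (n≤period (suc c) g^c≈1))
    canonical : a % n ≤ b % n ⊎ b % n ≤ a % n → a % n ≡ b % n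
    canonical (inj₁ a≤b) = below-n a≤b (m%n<n b n) g^a%n≈g^b%n
    canonical (inj₂ b≤a) = sym (below-n b≤a (m%n<n a n) (≈-sym g^a%n≈g^b%n))

  fermat : ∀ {x} → Unit x → x ^ n ≈ 1
  fermat {x} ux with k , g^k≈x ← log ux = begin
    x ^ n         ≈⟨ ^-congˡ n g^k≈x ⟨
    (g ^ k) ^ n   ≡⟨ ^-*-assoc g k n ⟩
    g ^ (k * n)   ≈⟨ ^-cong-% (trans (m*n%n≡0 k n) (sym (m*n%n≡0 0 n))) ⟩
    1             ∎
    where open ≈-Reasoning

  ^-+-cancelʳ : ∀ a b → g ^ (a + b) * (g ^ b) ^ pred n ≈ g ^ a
  ^-+-cancelʳ a b = begin
    g ^ (a + b) * (g ^ b) ^ pred n   ≡⟨ cong (g ^ (a + b) *_) (^-*-assoc g b (pred n)) ⟩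
    g ^ (a + b) * g ^ (b * pred n)   ≡⟨ ^-distribˡ-+-* g (a + b) (b * pred n) ⟨
    g ^ (a + b + b * pred n)         ≡⟨ cong (g ^_) exponent ⟩
    g ^ (a + b * n)                  ≈⟨ ^-cong-% ([m+kn]%n≡m%n a b n) ⟩
    g ^ a                            ∎
    where
    open ≈-Reasoning
    exponent : a + b + b * pred n ≡ a + b * n
    exponent = trans (+-assoc a b (b * pred n)) (cong (a +_) (trans (sym (*-suc b (pred n))) (cong (b *_) (suc-pred n))))

  log-inverse : ∀ {h} k k′ → h ≈ g ^ k → g ≈ h ^ k′ → (k * k′) % n ≡ 1 % n
  log-inverse {h} k k′ h≈g^k g≈h^k′ = sym (^-injective-% (begin
    g ^ 1          ≡⟨ *-identityʳ g ⟩
    g              ≈⟨ g≈h^k′ ⟩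
    h ^ k′         ≈⟨ ^-congˡ k′ h≈g^k ⟩
    (g ^ k) ^ k′   ≡⟨ ^-*-assoc g k k′ ⟩
    g ^ (k * k′)   ∎))
    where open ≈-Reasoning

module SubgroupL (n : ℕ) (p-prime : Prime (suc n)) (2≤n : 2 ≤ n)
                 (g : ℕ) (g-primitive : IsPrimitiveRoot (suc n) g) where

  open PrimitiveRoot n p-prime g g-primitive
  open Congruence p
  open Units p p-prime

  -- x mod p lies in L = ⟨−1, 2⟩, where n ≡ −1 (mod p).
  record InL (x : ℕ) : Set where
    constructor ±2^
    field
      sign exponent : ℕ
      ≈-normal : x ≈ n ^ sign * 2 ^ exponent

  InL-≈ : ∀ {x y} → x ≈ y → InL x → InL y
  InL-≈ x≈y (±2^ s b x≈) = ±2^ s b (≈-trans (≈-sym x≈y) x≈)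

  InL-1 : InL 1
  InL-1 = ±2^ 0 0 ≈-refl

  InL-* : ∀ {x y} → InL x → InL y → InL (x * y)
  InL-* {x} {y} (±2^ s b x≈) (±2^ t c y≈) = ±2^ (s + t) (b + c) (begin
    x * y                               ≈⟨ *-cong x≈ y≈ ⟩
    (n ^ s * 2 ^ b) * (n ^ t * 2 ^ c)   ≡⟨ *-interchange (n ^ s) (2 ^ b) (n ^ t) (2 ^ c) ⟩
    (n ^ s * n ^ t) * (2 ^ b * 2 ^ c)   ≡⟨ cong₂ _*_ (^-distribˡ-+-* n s t) (^-distribˡ-+-* 2 b c) ⟨
    n ^ (s + t) * 2 ^ (b + c)           ∎)
    where open ≈-Reasoning

  InL-^ : ∀ {x} k → InL x → InL (x ^ k)
  InL-^ zero _ = InL-1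
  InL-^ (suc k) x∈L = InL-* x∈L (InL-^ k x∈L)

  n-unit : Unit n
  n-unit = unit λ n%p≡0 → ≢-nonZero⁻¹ n (trans (sym (m<n⇒m%n≡m (n<1+n n))) n%p≡0)

  2-unit : Unit 2
  2-unit = unit λ 2%p≡0 → 0≢1+n (trans (sym 2%p≡0) (m<n⇒m%n≡m (s≤s 2≤n)))

  InL⇒Unit : ∀ {x} → InL x → Unit x
  InL⇒Unit (±2^ s b x≈) = Unit-≈ (≈-sym x≈) (Unit-* (Unit-^ s n-unit) (Unit-^ b 2-unit))

  n^2≈1 : n ^ 2 ≈ 1
  n^2≈1 = +-cancelˡ-≈ n (begin
    n + n ^ 2     ≡⟨ cong (λ k → n + n * k) (*-identityʳ n) ⟩
    n + n * n     ≡⟨ *-suc n n ⟨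
    n * p         ≈⟨ ≡-mod (trans (m*n%n≡0 n p) (sym (n%n≡0 p))) ⟩
    p             ≡⟨ +-comm n 1 ⟨
    n + 1         ∎)
    where open ≈-Reasoning

  p∸≈n* : ∀ {a} → a ≤ p → p ∸ a ≈ n * a
  p∸≈n* {a} a≤p = +-cancelˡ-≈ a (begin
    a + (p ∸ a)   ≡⟨ m+[n∸m]≡n a≤p ⟩
    p             ≈⟨ ≡-mod (trans (n%n≡0 p) (sym (m*n%n≡0 a p))) ⟩
    a * p         ≡⟨ *-suc a n ⟩
    a + a * n     ≡⟨ cong (a +_) (*-comm a n) ⟩
    a + n * a     ∎)
    where open ≈-Reasoning

  positive-≈ : ∀ b → 2 ^ b % p ≈ n ^ 0 * 2 ^ b
  positive-≈ b = ≈-trans (%-≈ (2 ^ b)) (≡⇒≈ (sym (*-identityˡ (2 ^ b))))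

  negative-≈ : ∀ b → (p ∸ 2 ^ b % p) % p ≈ n ^ 1 * 2 ^ b
  negative-≈ b = begin
    (p ∸ 2 ^ b % p) % p   ≈⟨ %-≈ (p ∸ 2 ^ b % p) ⟩
    p ∸ 2 ^ b % p         ≈⟨ p∸≈n* (m%n≤n (2 ^ b) p) ⟩
    n * (2 ^ b % p)       ≈⟨ *-congˡ n (%-≈ (2 ^ b)) ⟩
    n * 2 ^ b             ≡⟨ cong (_* 2 ^ b) (*-identityʳ n) ⟨
    n ^ 1 * 2 ^ b         ∎
    where open ≈-Reasoning

  ∈Lelems⇒InL : ∀ {y} → y ∈ Lelems p → InL y
  ∈Lelems⇒InL y∈ with ∈-++⁻ (map (λ b → 2 ^ b % p) (upTo n)) y∈
  ... | inj₁ y∈⁺ with b , _ , refl ← ∈-map⁻ (λ b → 2 ^ b % p) y∈⁺ = ±2^ 0 b (positive-≈ b)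
  ... | inj₂ y∈⁻ with b , _ , refl ← ∈-map⁻ (λ b → (p ∸ 2 ^ b % p) % p) y∈⁻ = ±2^ 1 b (negative-≈ b)

  ∈Lelems-canonical : ∀ {s b} → s < 2 → b < n → ∃[ y ] y ∈ Lelems p × y ≈ n ^ s * 2 ^ b
  ∈Lelems-canonical {zero} {b} _ b<n =
    2 ^ b % p , ∈-++⁺ˡ (∈-map⁺ (λ b → 2 ^ b % p) (∈-upTo⁺ b<n)) , positive-≈ b
  ∈Lelems-canonical {suc zero} {b} _ b<n =
    (p ∸ 2 ^ b % p) % p ,
    ∈-++⁺ʳ (map (λ b → 2 ^ b % p) (upTo n)) (∈-map⁺ (λ b → (p ∸ 2 ^ b % p) % p) (∈-upTo⁺ b<n)) ,
    negative-≈ b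
  ∈Lelems-canonical {2+ _} (s≤s (s≤s ())) _

  InL⇒∈Lelems : ∀ {x} → InL x → ∃[ y ] y ∈ Lelems p × y ≈ x
  InL⇒∈Lelems {x} (±2^ s b x≈) with y , y∈ , y≈ ← ∈Lelems-canonical (m%n<n s 2) (m%n<n b n) =
    y , y∈ , ≈-trans y≈ (≈-trans (≈-sym canonical) (≈-sym x≈))
    where
    canonical : n ^ s * 2 ^ b ≈ n ^ (s % 2) * 2 ^ (b % n)
    canonical = *-cong (^-reduce 2 n^2≈1 s) (^-reduce n (fermat 2-unit) b)

  InL⇒InCoset : ∀ {x} → InL x → InCoset p 0 1 (x % p)
  InL⇒InCoset {x} x∈L = let (y , y∈ , y≈x) = InL⇒∈Lelems x∈L in
    lose y∈ (residue-≡ (≈-trans (≡⇒≈ (*-identityˡ y)) y≈x))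

  InCoset⇒InL : ∀ {x} → InCoset p 0 1 (x % p) → InL x
  InCoset⇒InL x∈ with y , y∈ , y≡x ← find x∈ =
    InL-≈ (≈-trans (≡⇒≈ (sym (*-identityˡ y))) (≡-mod {1 * y} y≡x)) (∈Lelems⇒InL y∈)

  InL? : Decidable InL
  InL? x = map′ InCoset⇒InL InL⇒InCoset (inCoset? p 0 1 (x % p))

  InCoset-transfer : ∀ a {c c′ u x} → c ≈ c′ * u → InL u → InCoset p a c x → InCoset p a c′ x
  InCoset-transfer a {c} {c′} {u} c≈c′u u∈L x∈ =
    let (y , y∈ , a+cy≡x) = find x∈
        (y′ , y′∈ , y′≈uy) = InL⇒∈Lelems (InL-* u∈L (∈Lelems⇒InL y∈))
    in lose y′∈ (trans (residue-≡ (begin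
      a + c′ * y′         ≈⟨ +-congˡ a (*-congˡ c′ y′≈uy) ⟩
      a + c′ * (u * y)    ≡⟨ cong (a +_) (*-assoc c′ u y) ⟨
      a + c′ * u * y      ≈⟨ +-congˡ a (*-congʳ y c≈c′u) ⟨
      a + c * y           ∎)) a+cy≡x)
    where open ≈-Reasoning

  InL-^-+ : ∀ {a b} → InL (g ^ a) → InL (g ^ b) → InL (g ^ (a + b))
  InL-^-+ {a} {b} a∈L b∈L = InL-≈ (≡⇒≈ (sym (^-distribˡ-+-* g a b))) (InL-* a∈L b∈L)

  InL-^-∸ : ∀ {a b} → InL (g ^ (a + b)) → InL (g ^ b) → InL (g ^ a)
  InL-^-∸ {a} {b} a+b∈L b∈L = InL-≈ (^-+-cancelʳ a b) (InL-* a+b∈L (InL-^ (pred n) b∈L))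

  opaque
    exponents : ∃[ d ] (λ j → InL (g ^ j)) ≐ (suc d ∣_)
    exponents = ≐-multiples (λ j → InL? (g ^ j)) (λ {a} {b} → InL-^-+ {a} {b}) (λ {a} {b} → InL-^-∸ {a} {b})
      {pred n} (subst (λ e → InL (g ^ e)) (sym (suc-pred n)) (InL-≈ (≈-sym g^n≈1) InL-1))

  -- The order of g modulo L; it turns out to be the index ℓ.
  d : ℕ
  d = suc (proj₁ exponents)

  InL-^⇒∣ : ∀ {j} → InL (g ^ j) → d ∣ j
  InL-^⇒∣ = proj₁ (proj₂ exponents)

  ∣⇒InL-^ : ∀ {j} → d ∣ j → InL (g ^ j)
  ∣⇒InL-^ = proj₂ (proj₂ exponents)

  d∣n : d ∣ n
  d∣n = InL-^⇒∣ (InL-≈ (≈-sym g^n≈1) InL-1)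

  d*[n/d]≡n : d * (n / d) ≡ n
  d*[n/d]≡n = m*[n/m]≡n d∣n

  cardL≡n/d : cardL p ≡ n / d
  cardL≡n/d = trans (↭.↭-length L-residues↭powers) (trans (length-map power (upTo (n / d))) (length-upTo (n / d)))
    where
    power : ℕ → ℕ
    power t = g ^ (d * t) % p

    d*t<n : ∀ {t} → t < n / d → d * t < n
    d*t<n {t} t<n/d = subst (d * t <_) d*[n/d]≡n (*-monoʳ-< d t<n/d)

    power-injective : ∀ {t t′} → t ∈ upTo (n / d) → t′ ∈ upTo (n / d) → power t ≡ power t′ → t ≡ t′
    power-injective {t} {t′} t∈ t′∈ eq = *-cancelˡ-≡ t t′ d
      (m%n≡o%n⇒m≡o (d*t<n (∈-upTo⁻ t∈)) (d*t<n (∈-upTo⁻ t′∈)) (^-injective-% (≡-mod eq)))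

    ∈L-residues⇒ : ∀ {x} → x ∈ filter (λ x → inCoset? p 0 1 x) (upTo p) → x ∈ map power (upTo (n / d))
    ∈L-residues⇒ {x} x∈ with x∈upTo , x∈L₀ ← ∈-filter⁻ (λ x → inCoset? p 0 1 x) x∈ =
      subst (_∈ map power (upTo (n / d))) (sym x≡power-q) (∈-map⁺ power (∈-upTo⁺ q<n/d))
      where
      x<p : x < p
      x<p = ∈-upTo⁻ x∈upTo
      x∈L : InL x
      x∈L = InCoset⇒InL (subst (InCoset p 0 1) (sym (m<n⇒m%n≡m x<p)) x∈L₀)
      k : ℕ
      k = proj₁ (log (InL⇒Unit x∈L))
      g^k≈x : g ^ k ≈ x
      g^k≈x = proj₂ (log (InL⇒Unit x∈L))
      d∣k%n : d ∣ k % n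
      d∣k%n = %-presˡ-∣ (InL-^⇒∣ (InL-≈ (≈-sym g^k≈x) x∈L)) d∣n
      q : ℕ
      q = quotient d∣k%n
      q<n/d : q < n / d
      q<n/d = *-cancelʳ-< d q (n / d) (subst₂ _<_ (_∣_.equality d∣k%n) (sym (m/n*n≡m d∣n)) (m%n<n k n))
      x≡power-q : x ≡ power q
      x≡power-q = trans (sym (m<n⇒m%n≡m x<p)) (residue-≡ (begin
        x             ≈⟨ g^k≈x ⟨
        g ^ k         ≈⟨ ^-reduce n g^n≈1 k ⟩
        g ^ (k % n)   ≡⟨ cong (g ^_) (trans (_∣_.equality d∣k%n) (*-comm q d)) ⟩
        g ^ (d * q)   ∎))
        where open ≈-Reasoning

    powers⇒∈L-residues : ∀ {x} → x ∈ map power (upTo (n / d)) → x ∈ filter (λ x → inCoset? p 0 1 x) (upTo p)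
    powers⇒∈L-residues x∈ with t , _ , refl ← ∈-map⁻ power x∈ =
      ∈-filter⁺ (λ x → inCoset? p 0 1 x) (∈-upTo⁺ (m%n<n (g ^ (d * t)) p)) (InL⇒InCoset (∣⇒InL-^ (m∣m*n t)))

    L-residues↭powers : filter (λ x → inCoset? p 0 1 x) (upTo p) ↭ map power (upTo (n / d))
    L-residues↭powers = unique∧set⇒↭ (Unique.filter⁺ (λ x → inCoset? p 0 1 x) (Unique.upTo⁺ p))
      (map⁺-injectiveOn power-injective (Unique.upTo⁺ (n / d))) ∈L-residues⇒ powers⇒∈L-residues

  *cardL≡n⇒≡d : ∀ {ℓ} → ℓ * cardL p ≡ n → ℓ ≡ d
  *cardL≡n⇒≡d {ℓ} ℓ*|L|≡n = *-cancelʳ-≡ ℓ d (n / d) {{n/d≢0}}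
    (trans (subst (λ c → ℓ * c ≡ n) cardL≡n/d ℓ*|L|≡n) (sym d*[n/d]≡n))
    where
    n/d≢0 : NonZero (n / d)
    n/d≢0 = m*n≢0⇒n≢0 d {{subst NonZero (sym d*[n/d]≡n) n-nonZero}}

  InCoset-^-cong : ∀ a {c c′} i i′ {x} → c ≈ g ^ i → c′ ≈ g ^ i′ → i % d ≡ i′ % d →
                   InCoset p a c x → InCoset p a c′ x
  InCoset-^-cong a {c} {c′} i i′ c≈g^i c′≈g^i′ i≡i′ = InCoset-transfer a {c} {c′} c≈c′u u∈L
    where
    u : ℕ
    u = g ^ i * (g ^ i′) ^ pred n
    u∈L : InL u
    u∈L = InL-≈ (≡⇒≈ (trans (^-distribˡ-+-* g i (i′ * pred n)) (cong (g ^ i *_) (sym (^-*-assoc g i′ (pred n))))))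
      (∣⇒InL-^ (%-≡⇒∣-+ {i = i} {i′} i≡i′ (subst (d ∣_) (sym i′+i′*pred-n≡i′*n) (∣n⇒∣m*n i′ d∣n))))
      where
      i′+i′*pred-n≡i′*n : i′ + i′ * pred n ≡ i′ * n
      i′+i′*pred-n≡i′*n = trans (sym (*-suc i′ (pred n))) (cong (i′ *_) (suc-pred n))
    c≈c′u : c ≈ c′ * u
    c≈c′u = begin
      c                                    ≈⟨ c≈g^i ⟩
      g ^ i                                ≈⟨ ^-+-cancelʳ i i′ ⟨
      g ^ (i + i′) * (g ^ i′) ^ pred n     ≡⟨ cong (λ e → g ^ e * (g ^ i′) ^ pred n) (+-comm i i′) ⟩
      g ^ (i′ + i) * (g ^ i′) ^ pred n     ≡⟨ cong (_* (g ^ i′) ^ pred n) (^-distribˡ-+-* g i′ i) ⟩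
      g ^ i′ * g ^ i * (g ^ i′) ^ pred n   ≡⟨ *-assoc (g ^ i′) (g ^ i) ((g ^ i′) ^ pred n) ⟩
      g ^ i′ * u                           ≈⟨ *-congʳ u c′≈g^i′ ⟨
      c′ * u                               ∎
      where open ≈-Reasoning

  A-cong : ∀ {b k i j i′ j′} → b ≈ g ^ k → (k * i) % d ≡ i′ % d → (k * j) % d ≡ j′ % d →
           A p b i j ≡ A p g i′ j′
  A-cong {b} {k} {i} {j} {i′} {j′} b≈g^k ki≡i′ kj≡j′ =
    cong length (filter-≐ (λ x → inCoset? p 1 (b ^ i) x ×-dec inCoset? p 0 (b ^ j) x)
                          (λ x → inCoset? p 1 (g ^ i′) x ×-dec inCoset? p 0 (g ^ j′) x)
                          (to , from) (upTo p))
    where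
    b^≈g^k* : ∀ e → b ^ e ≈ g ^ (k * e)
    b^≈g^k* e = ≈-trans (^-congˡ e b≈g^k) (≡⇒≈ (^-*-assoc g k e))
    to : ∀ {x} → InCoset p 1 (b ^ i) x × InCoset p 0 (b ^ j) x → InCoset p 1 (g ^ i′) x × InCoset p 0 (g ^ j′) x
    to (x∈₁ , x∈₂) = InCoset-^-cong 1 (k * i) i′ (b^≈g^k* i) ≈-refl ki≡i′ x∈₁ ,
                     InCoset-^-cong 0 (k * j) j′ (b^≈g^k* j) ≈-refl kj≡j′ x∈₂
    from : ∀ {x} → InCoset p 1 (g ^ i′) x × InCoset p 0 (g ^ j′) x → InCoset p 1 (b ^ i) x × InCoset p 0 (b ^ j) x
    from (x∈₁ , x∈₂) = InCoset-^-cong 1 i′ (k * i) ≈-refl (b^≈g^k* i) (sym ki≡i′) x∈₁ ,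
                       InCoset-^-cong 0 j′ (k * j) ≈-refl (b^≈g^k* j) (sym kj≡j′) x∈₂

module CoprimeResidues (ℓ : ℕ) .{{_ : NonZero ℓ}} (1<ℓ : 1 < ℓ) where

  open Congruence ℓ

  coprimes : List ℕ
  coprimes = filter (λ i → gcd i ℓ ≟ 1) (map suc (upTo ℓ))

  ∈coprimes⇒ : ∀ {i} → i ∈ coprimes → 0 < i × i < ℓ × gcd i ℓ ≡ 1
  ∈coprimes⇒ i∈ with i∈suc-upTo , gcd≡1 ← ∈-filter⁻ (λ i → gcd i ℓ ≟ 1) {xs = map suc (upTo ℓ)} i∈
                 with j , j∈ , refl ← ∈-map⁻ suc i∈suc-upTo
                 with m<1+n⇒m<n∨m≡n (s≤s (∈-upTo⁻ j∈))
  ... | inj₁ 1+j<ℓ = z<s , 1+j<ℓ , gcd≡1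
  ... | inj₂ refl = contradiction (∣1⇒≡1 (subst (ℓ ∣_) gcd≡1 (gcd-greatest ∣-refl ∣-refl))) (>⇒≢ 1<ℓ)

  ⇒∈coprimes : ∀ {i} → 0 < i → i < ℓ → gcd i ℓ ≡ 1 → i ∈ coprimes
  ⇒∈coprimes {suc j} _ i<ℓ gcd≡1 = ∈-filter⁺ (λ i → gcd i ℓ ≟ 1) (∈-map⁺ suc (∈-upTo⁺ (<⇒≤ i<ℓ))) gcd≡1

  %-inverse : ∀ k k′ → (k′ * k) % ℓ ≡ 1 → ∀ i → k′ * (k * i % ℓ) ≈ i
  %-inverse k k′ k′k≡1 i = begin
    k′ * (k * i % ℓ)   ≈⟨ *-congˡ k′ (%-≈ (k * i)) ⟩
    k′ * (k * i)       ≡⟨ *-assoc k′ k i ⟨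
    k′ * k * i         ≈⟨ *-congʳ i (≡-mod (trans k′k≡1 (sym (m<n⇒m%n≡m 1<ℓ)))) ⟩
    1 * i              ≡⟨ *-identityˡ i ⟩
    i                  ∎
    where open ≈-Reasoning

  ∈coprimes-*-% : ∀ k k′ {i} → (k′ * k) % ℓ ≡ 1 → i ∈ coprimes → k * i % ℓ ∈ coprimes
  ∈coprimes-*-% k k′ {i} k′k≡1 i∈ with 0<i , i<ℓ , gcd≡1 ← ∈coprimes⇒ i∈ =
    ⇒∈coprimes 0<σ (m%n<n (k * i) ℓ) gcd[σ,ℓ]≡1
    where
    σ : ℕ
    σ = k * i % ℓ
    k′σ%ℓ≡i : k′ * σ % ℓ ≡ i
    k′σ%ℓ≡i = trans (residue-≡ (%-inverse k k′ k′k≡1 i)) (m<n⇒m%n≡m i<ℓ)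
    0<σ : 0 < σ
    0<σ with σ in σ≡
    ... | zero = contradiction i≡0 (>⇒≢ 0<i)
      where
      i≡0 : i ≡ 0
      i≡0 = trans (sym k′σ%ℓ≡i) (trans (cong (λ r → k′ * r % ℓ) σ≡) (trans (cong (_% ℓ) (*-zeroʳ k′)) (m*n%n≡0 0 ℓ)))
    ... | suc _ = z<s
    gcd[σ,ℓ]≡1 : gcd σ ℓ ≡ 1
    gcd[σ,ℓ]≡1 = ∣1⇒≡1 (subst (gcd σ ℓ ∣_) gcd≡1 (gcd-greatest gcd∣i (gcd[m,n]∣n σ ℓ)))
      where
      gcd∣i : gcd σ ℓ ∣ i
      gcd∣i = subst (gcd σ ℓ ∣_) k′σ%ℓ≡i (%-presˡ-∣ (∣n⇒∣m*n k′ (gcd[m,n]∣m σ ℓ)) (gcd[m,n]∣n σ ℓ))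

  sum-reindex : ∀ k k′ → (k * k′) % ℓ ≡ 1 → (F : ℕ → ℕ) →
                sum (map (λ i → F (k * i % ℓ)) coprimes) ≡ sum (map F coprimes)
  sum-reindex k k′ kk′≡1 F =
    trans (cong sum (map-∘ coprimes)) (sum-↭ (↭.map⁺ F σ-coprimes↭coprimes))
    where
    k′k≡1 : (k′ * k) % ℓ ≡ 1
    k′k≡1 = trans (cong (_% ℓ) (*-comm k′ k)) kk′≡1
    σ : ℕ → ℕ
    σ i = k * i % ℓ
    σ-injective : ∀ {i j} → i ∈ coprimes → j ∈ coprimes → σ i ≡ σ j → i ≡ j
    σ-injective {i} {j} i∈ j∈ σi≡σj = m%n≡o%n⇒m≡o (proj₁ (proj₂ (∈coprimes⇒ i∈))) (proj₁ (proj₂ (∈coprimes⇒ j∈)))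
      (residue-≡ (≈-trans (≈-sym (%-inverse k k′ k′k≡1 i)) (≈-trans (≡⇒≈ (cong (k′ *_) σi≡σj)) (%-inverse k k′ k′k≡1 j))))
    σ-onto : ∀ {j} → j ∈ coprimes → j ∈ map σ coprimes
    σ-onto {j} j∈ = subst (_∈ map σ coprimes) σk′j≡j (∈-map⁺ σ (∈coprimes-*-% k′ k kk′≡1 j∈))
      where
      σk′j≡j : σ (k′ * j % ℓ) ≡ j
      σk′j≡j = trans (residue-≡ (%-inverse k′ k kk′≡1 j)) (m<n⇒m%n≡m (proj₁ (proj₂ (∈coprimes⇒ j∈))))
    σ-into : ∀ {j} → j ∈ map σ coprimes → j ∈ coprimes
    σ-into j∈ with i , i∈ , refl ← ∈-map⁻ σ j∈ = ∈coprimes-*-% k k′ k′k≡1 i∈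
    σ-coprimes↭coprimes : map σ coprimes ↭ coprimes
    σ-coprimes↭coprimes = unique∧set⇒↭ (map⁺-injectiveOn σ-injective coprimes-unique) coprimes-unique σ-into σ-onto
      where
      coprimes-unique : Unique coprimes
      coprimes-unique = Unique.filter⁺ (λ i → gcd i ℓ ≟ 1) (Unique.map⁺ suc-injective (Unique.upTo⁺ ℓ))

s-independent : ∀ n → Prime (suc n) → 2 ≤ n → ∀ ℓ → ℓ * cardL (suc n) ≡ n → 2 ≤ ℓ →
                ∀ g h → IsPrimitiveRoot (suc n) g → IsPrimitiveRoot (suc n) h →
                s (suc n) g ℓ ≡ s (suc n) h ℓ
s-independent n p-prime 2≤n ℓ ℓ*|L|≡n 2≤ℓ g h g-primitive h-primitive =
  subst (λ ℓ → s p g ℓ ≡ s p h ℓ) (sym ℓ≡d) (begin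
    s p g d                                                          ≡⟨ sum-reindex k k′ kk′≡1 (λ i → A p g i (2 * i)) ⟨
    sum (map (λ i → A p g (k * i % d) (2 * (k * i % d))) coprimes)   ≡⟨ cong sum (map-cong A-h≡A-g coprimes) ⟨
    s p h d                                                          ∎)
  where
  open SubgroupL n p-prime 2≤n g g-primitive
  open PrimitiveRoot n p-prime g g-primitive using (p; n-nonZero; log; log-inverse; g-unit)
  open PrimitiveRoot n p-prime h h-primitive using () renaming (log to logₕ; g-unit to h-unit)
  open Congruence p using (_≈_; ≈-sym)
  module Mod-d = Congruence d
  open ≡-Reasoning

  ℓ≡d : ℓ ≡ d
  ℓ≡d = *cardL≡n⇒≡d ℓ*|L|≡n

  1<d : 1 < d
  1<d = subst (2 ≤_) ℓ≡d 2≤ℓ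

  open CoprimeResidues d 1<d

  k : ℕ
  k = proj₁ (log h-unit)
  h≈g^k : h ≈ g ^ k
  h≈g^k = ≈-sym (proj₂ (log h-unit))

  k′ : ℕ
  k′ = proj₁ (logₕ g-unit)
  g≈h^k′ : g ≈ h ^ k′
  g≈h^k′ = ≈-sym (proj₂ (logₕ g-unit))

  kk′≡1 : k * k′ % d ≡ 1
  kk′≡1 = begin
    k * k′ % d       ≡⟨ m∣n⇒o%n%m≡o%m d n (k * k′) d∣n ⟨
    k * k′ % n % d   ≡⟨ cong (_% d) (log-inverse k k′ h≈g^k g≈h^k′) ⟩
    1 % n % d        ≡⟨ m∣n⇒o%n%m≡o%m d n 1 d∣n ⟩
    1 % d            ≡⟨ m<n⇒m%n≡m 1<d ⟩
    1                ∎

  A-h≡A-g : ∀ i → A p h i (2 * i) ≡ A p g (k * i % d) (2 * (k * i % d))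
  A-h≡A-g i = A-cong {h} {k} {i} {2 * i} {k * i % d} {2 * (k * i % d)} h≈g^k
    (sym (m%n%n≡m%n (k * i) d)) (Mod-d.residue-≡ k[2i]≈2[ki%d])
    where
    k[2i]≈2[ki%d] : k * (2 * i) Mod-d.≈ 2 * (k * i % d)
    k[2i]≈2[ki%d] = Mod-d.≈-trans (Mod-d.≡⇒≈ (*-left-comm k 2 i)) (Mod-d.*-congˡ 2 (Mod-d.≈-sym (Mod-d.%-≈ (k * i))))

proposition2p2 : (p : ℕ) .{{_ : NonZero p}} → Prime p → ¬ (p ≡ 2) →
    (ℓ : ℕ) → ℓ * cardL p ≡ p ∸ 1 → 3 ≤ ℓ →
    (g h : ℕ) → IsPrimitiveRoot p g → IsPrimitiveRoot p h →
    s p g ℓ ≡ s p h ℓ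
proposition2p2 (suc (suc (suc n))) p-prime _ ℓ ℓ*|L|≡p-1 3≤ℓ =
  s-independent (suc (suc n)) p-prime (s≤s (s≤s z≤n)) ℓ ℓ*|L|≡p-1 (≤-trans (n≤1+n 2) 3≤ℓ)
proposition2p2 (suc (suc zero)) _ p≢2 = contradiction refl p≢2
proposition2p2 (suc zero) p-prime _ = contradiction refl (nonTrivial⇒≢1 {{prime⇒nonTrivial p-prime}})
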